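{- Let $X$ be a finite set and $n\in\mathbb{N}$. If $X$ is $\omega^{n+2}$-large${}^*(\theta)$ and exp-sparse, and $f:X\to\min X$ is a coloring, then $X$ has an $f$-homogeneous (monochromatic) subset which is $\omega^n$-large${}^*(\theta)$.
   Context: Fix a $\Delta^0_0$ formula $\theta(x,y,z)$. For finite sets, $A<B$ means every element of $A$ is below every element of $B$. Finite sets $E<F$ are $\theta$-apart if $\forall x<\max E\ \exists y<\min F\ \forall z<\max F\ \theta(x,y,z)$. For a family $\mathcal{L}$ of finite sets and $k$, $\mathcal{L}\cdot k$ is the family of finite sets containing $k$ pairwise $\theta$-apart sets $X_0<\dots<X_{k-1}$ each in $\mathcal{L}$; $\mathcal{L}\cdot()=\mathcal{L}$, $\mathcal{L}\cdot(k,k_2,\dots,k_s)=(\mathcal{L}\cdot k)\cdot(k_2,\dots,k_s)$. $L^\theta_0$ is the nonempty finite sets; $L^\theta_{n+1}$ is the nonempty finite $X$ with $X\setminus\{\min X\}\in L^\theta_n\cdot(\min X,\dots,\min X)$ ($n+1$ entries); $X$ is $\omega^n$-large${}^*(\theta)$ if $X\in L^\theta_n$. $X$ is exp-sparse if $4^x<y$ for all $x<y$ in $X$. An integer $m$ is identified with $\{0,\dots,m-1\}$. -}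

module Defs where

open import Data.Nat using (ℕ; zero; suc; _<_; _^_; _⊔_)
open import Data.List using (List; []; _∷_; length; foldr)
open import Data.List.Membership.Propositional using (_∈_)
open import Data.List.Relation.Unary.All using (All)
open import Data.List.Relation.Unary.AllPairs using (AllPairs)
open import Data.List.Relation.Unary.Linked using (Linked)
open import Data.List.Relation.Binary.Subset.Propositional using (_⊆_)
open import Data.Product using (Σ; ∃; _×_)
open import Data.Empty using (⊥)
open import Relation.Binary.PropositionalEquality using (_≡_; _≢_)

-- A finite set of naturals is represented by a strictly increasing list.
IsFinSet : List ℕ → Set
IsFinSet X = Linked _<_ X

minL : List ℕ → ℕ
minL []      = 0
minL (x ∷ _) = x

maxL : List ℕ → ℕ
maxL = foldr _⊔_ 0

_<ˢ_ : List ℕ → List ℕ → Set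
A <ˢ B = ∀ {a b} → a ∈ A → b ∈ B → a < b

-- a (Δ⁰₀) formula θ(x,y,z), represented by the relation it defines
Formula : Set₁
Formula = ℕ → ℕ → ℕ → Set

Apart : Formula → List ℕ → List ℕ → Set
Apart θ E F = ∀ x → x < maxL E → ∃ λ y → y < minL F × (∀ z → z < maxL F → θ x y z)

Family : Set₁
Family = List ℕ → Set

dot : Formula → Family → ℕ → Family
dot θ L k X =
  Σ (List (List ℕ)) λ Xs →
      length Xs ≡ k
    × All (λ Y → IsFinSet Y × L Y × Y ⊆ X) Xs
    × AllPairs (λ E F → E <ˢ F × Apart θ E F) Xs

dotIter : Formula → Family → ℕ → ℕ → Family
dotIter θ L k zero    = L
dotIter θ L k (suc j) = dotIter θ (dot θ L k) k j

Large : Formula → ℕ → Family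
Large θ zero    X       = X ≢ []
Large θ (suc n) []      = ⊥
Large θ (suc n) (m ∷ r) = dotIter θ (Large θ n) m (suc n) r

ExpSparse : List ℕ → Set
ExpSparse X = ∀ {x y} → x ∈ X → y ∈ X → x < y → 4 ^ x < y

-- Let m = min X, so f takes values below m. Call a block Y anchored when it contains a point p and a
-- set T coloured like p such that x ∷ T is ω^(n+1)-large* whenever m·x < min Y. Anchored blocks glue:
-- by exp-sparseness m·p < min Y' for every point p of a block Y < Y', so among more than m anchored
-- blocks two have anchors p, p' of equal colour, and p ∷ T' is homogeneous and ω^(n+1)-large*.
-- A block Y ⊆ X \ {m} that is ω^(n+2)-large* with min Y = b > m is anchored: Y \ {b} is
-- L_(n+1)·(b,…,b) with n+2 entries; each innermost L_(n+1)·b set has b > m blocks that are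
-- ω^(n+1)-large*, hence (one level down) anchored, so it contains a homogeneous ω^n-large* set; and at
-- each of the n+1 outer levels the homogeneous subsets of the b blocks, pigeonholed into m colours,
-- leave K = ⌊(b−1)/m⌋ of one colour. This gives T ∈ L_n·(K,…,K), and every x with m·x < b has x ≤ K.
-- Finally X \ {m} contains an L_(n+2)·m set, whose m blocks together with {m} are m+1 anchored blocks.

module Submission where

open import Defs
open import Data.Nat using (ℕ; zero; suc; pred; _<_; _≤_; _+_; _*_; _^_; z≤n; s≤s; _≟_; _<?_; NonZero; >-nonZero)
open import Data.Nat.Properties
open import Data.Nat.DivMod using (_/_; m/n*n≤m; m*n/n≡m; /-monoˡ-≤)
open import Data.List using (List; []; _∷_; length; map; concat; filter; take)
open import Data.List.Properties using (length-map; length-take; ++-conicalˡ)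
open import Data.List.Membership.Propositional using (_∈_)
open import Data.List.Membership.Propositional.Properties using (∈-map⁺; ∈-concat⁺′; ∈-filter⁻)
open import Data.List.Relation.Unary.Any using (here; there)
open import Data.List.Relation.Unary.All as All using (All; []; _∷_)
import Data.List.Relation.Unary.All.Properties as Allₚ
open import Data.List.Relation.Unary.AllPairs as AllPairs using (AllPairs; []; _∷_)
import Data.List.Relation.Unary.AllPairs.Properties as AllPairsₚ
open import Data.List.Relation.Unary.Linked using ([]; [-]; _∷_)
open import Data.List.Relation.Unary.Linked.Properties using (Linked⇒All; Linked⇒AllPairs; AllPairs⇒Linked)
open import Data.List.Relation.Binary.Subset.Propositional using (_⊆_)
import Data.List.Relation.Binary.Sublist.Propositional.Properties as Sublistₚ
open import Data.Product using (Σ; ∃; ∃₂; _×_; _,_; proj₁)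
open import Data.Empty using (⊥-elim)
open import Function using (id; _∘_; _on_)
open import Relation.Nullary using (Dec; yes; no)
open import Relation.Unary using (Decidable)
open import Relation.Unary.Properties using (∁?)
open import Relation.Binary.PropositionalEquality

n<2^n : ∀ n → n < 2 ^ n
n<2^n zero    = s≤s z≤n
n<2^n (suc n) = begin-strict
  suc n             ≤⟨ n<2^n n ⟩
  2 ^ n             <⟨ m<m+n (2 ^ n) (m^n>0 2 n) ⟩
  2 ^ n + 2 ^ n     ≡⟨ cong (2 ^ n +_) (sym (+-identityʳ (2 ^ n))) ⟩
  2 ^ suc n         ∎
  where open ≤-Reasoning

n*n<4^n : ∀ n → n * n < 4 ^ n
n*n<4^n n = begin-strict
  n * n             <⟨ *-mono-< (n<2^n n) (n<2^n n) ⟩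
  2 ^ n * 2 ^ n     ≡⟨ sym (^-distribˡ-+-* 2 n n) ⟩
  2 ^ (n + n)       ≡⟨ cong (λ k → 2 ^ (n + k)) (sym (+-identityʳ n)) ⟩
  2 ^ (2 * n)       ≡⟨ sym (^-*-assoc 2 2 n) ⟩
  4 ^ n             ∎
  where open ≤-Reasoning

m*[pred[n]/m]<n : ∀ m {n} .{{_ : NonZero m}} → 0 < n → m * (pred n / m) < n
m*[pred[n]/m]<n m {suc n} _ = s≤s (begin
  m * (n / m)       ≡⟨ *-comm m (n / m) ⟩
  n / m * m         ≤⟨ m/n*n≤m n m ⟩
  n                 ∎)
  where open ≤-Reasoning

m*o<n⇒o≤pred[n]/m : ∀ m {n} o .{{_ : NonZero m}} → m * o < n → o ≤ pred n / m
m*o<n⇒o≤pred[n]/m m {suc n} o mo<n = begin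
  o                 ≡⟨ sym (m*n/n≡m o m) ⟩
  o * m / m         ≤⟨ /-monoˡ-≤ m (subst (_≤ n) (*-comm m o) (≤-pred mo<n)) ⟩
  n / m             ∎
  where open ≤-Reasoning

length-filter-∁ : ∀ {A : Set} {P : A → Set} (P? : Decidable P) xs →
                  length (filter P? xs) + length (filter (∁? P?) xs) ≡ length xs
length-filter-∁ P? [] = refl
length-filter-∁ P? (x ∷ xs) with P? x
... | yes _ = cong suc (length-filter-∁ P? xs)
... | no  _ = trans (+-suc _ _) (cong suc (length-filter-∁ P? xs))

pigeonhole : ∀ {A : Set} (col : A → ℕ) m K (xs : List A) →
             All (λ a → col a < m) xs → m * K < length xs →
             ∃ λ c → K < length (filter (λ a → col a ≟ c) xs)
pigeonhole col zero    K []      _        ()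
pigeonhole col zero    K (x ∷ _) (() ∷ _) _
pigeonhole col (suc m) K xs cols big with K <? length (filter (λ a → col a ≟ m) xs)
... | yes K<top = m , K<top
... | no  K≮top =
  let c , K<c = pigeonhole col m K rest cols-rest big-rest
  in  c , <-≤-trans K<c (Sublistₚ.length-mono-≤ (Sublistₚ.filter⁺ (same c) (same c) (λ { refl q → q })
                                                  (Sublistₚ.filter-⊆ top? xs)))
  where
  same : ∀ c → Decidable (λ a → col a ≡ c)
  same c a = col a ≟ c
  top? = ∁? (same m)
  rest = filter top? xs
  cols-rest : All (λ a → col a < m) rest
  cols-rest = All.zipWith (λ (lt , ≢m) → ≤∧≢⇒< (≤-pred lt) ≢m)
                          (Allₚ.filter⁺ top? cols , Allₚ.all-filter top? xs)
  big-rest : m * K < length rest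
  big-rest = +-cancelˡ-< K (m * K) (length rest) (begin-strict
    K + m * K                                       <⟨ big ⟩
    length xs                                       ≡⟨ sym (length-filter-∁ (same m) xs) ⟩
    length (filter (same m) xs) + length rest       ≤⟨ +-monoˡ-≤ (length rest) (≮⇒≥ K≮top) ⟩
    K + length rest                                 ∎)
    where open ≤-Reasoning

first-pair : ∀ {A : Set} {R : A → A → Set} {xs} → 1 < length xs → AllPairs R xs →
             ∃₂ λ a b → a ∈ xs × b ∈ xs × R a b
first-pair {xs = _ ∷ []}    (s≤s ()) _
first-pair {xs = a ∷ b ∷ _} _ ((Rab ∷ _) ∷ _) = a , b , here refl , there (here refl) , Rab

pigeonhole-pair : ∀ {A : Set} {R : A → A → Set} (col : A → ℕ) m {xs} →
                  All (λ a → col a < m) xs → m < length xs → AllPairs R xs →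
                  ∃₂ λ a b → a ∈ xs × b ∈ xs × R a b × col a ≡ col b
pigeonhole-pair col m {xs} cols big ordered =
  let c , 1<same         = pigeonhole col m 1 xs cols (subst (_< length xs) (sym (*-identityʳ m)) big)
      same? : Decidable (λ a → col a ≡ c)
      same? a = col a ≟ c
      a , b , a∈ , b∈ , Rab = first-pair 1<same (AllPairsₚ.filter⁺ same? ordered)
      a∈xs , ca≡c        = ∈-filter⁻ same? a∈
      b∈xs , cb≡c        = ∈-filter⁻ same? b∈
  in  a , b , a∈xs , b∈xs , Rab , trans ca≡c (sym cb≡c)

map-reduce : ∀ {A B : Set} {P : A → Set} (h : B → A) (g : ∀ {x} → P x → B) →
             (∀ {x} (p : P x) → h (g p) ≡ x) → ∀ {xs} (ps : All P xs) → map h (All.reduce g ps) ≡ xs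
map-reduce h g section []       = refl
map-reduce h g section (p ∷ ps) = cong₂ _∷_ (section p) (map-reduce h g section ps)

head-below : ∀ {x y xs} → IsFinSet (x ∷ xs) → y ∈ xs → x < y
head-below [-]          ()
head-below (x<z ∷ rest) = All.lookup (Linked⇒All <-trans x<z rest)

sorted-cons : ∀ {x xs} → (∀ {y} → y ∈ xs → x < y) → IsFinSet xs → IsFinSet (x ∷ xs)
sorted-cons below []         = [-]
sorted-cons below [-]        = below (here refl) ∷ [-]
sorted-cons below (lt ∷ lts) = below (here refl) ∷ lt ∷ lts

minL-∈ : ∀ {Y} → Y ≢ [] → minL Y ∈ Y
minL-∈ {[]}    Y≢[] = ⊥-elim (Y≢[] refl)
minL-∈ {_ ∷ _} _    = here refl

∈⇒≢[] : ∀ {y : ℕ} {Y} → y ∈ Y → Y ≢ []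
∈⇒≢[] {Y = []}    ()
∈⇒≢[] {Y = _ ∷ _} _ ()

minL-≤ : ∀ {Y y} → IsFinSet Y → y ∈ Y → minL Y ≤ y
minL-≤ sorted (here refl) = ≤-refl
minL-≤ sorted (there y∈)  = <⇒≤ (head-below sorted y∈)

≤-maxL : ∀ {y Y} → y ∈ Y → y ≤ maxL Y
≤-maxL {y} {_ ∷ Y} (here refl) = m≤m⊔n y (maxL Y)
≤-maxL {_} {z ∷ _} (there y∈)  = ≤-trans (≤-maxL y∈) (m≤n⊔m z _)

maxL-mono-⊆ : ∀ {Y Y'} → Y ⊆ Y' → maxL Y ≤ maxL Y'
maxL-mono-⊆ {[]}    _     = z≤n
maxL-mono-⊆ {_ ∷ _} Y⊆Y' = ⊔-lub (≤-maxL (Y⊆Y' (here refl))) (maxL-mono-⊆ (Y⊆Y' ∘ there))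

Apart-⊆ : ∀ {θ E F E' F'} → IsFinSet F → F' ≢ [] → E' ⊆ E → F' ⊆ F → Apart θ E F → Apart θ E' F'
Apart-⊆ sorted F'≢[] E'⊆E F'⊆F apart x x<maxE' with apart x (<-≤-trans x<maxE' (maxL-mono-⊆ E'⊆E))
... | y , y<minF , θxy = y , <-≤-trans y<minF (minL-≤ sorted (F'⊆F (minL-∈ F'≢[]))) ,
                          λ z z<maxF' → θxy z (<-≤-trans z<maxF' (maxL-mono-⊆ F'⊆F))

Separated : Formula → List ℕ → List ℕ → Set
Separated θ E F = E <ˢ F × Apart θ E F

module _ {θ : Formula} where

  dot-mono : ∀ {L L' : Family} {k k' Z} → (∀ {Y} → L Y → L' Y) → k' ≤ k → dot θ L k Z → dot θ L' k' Z
  dot-mono {k' = k'} L⇒L' k'≤k (Ys , refl , blocks , separated) =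
    take k' Ys , trans (length-take k' Ys) (m≤n⇒m⊓n≡m k'≤k) ,
    Allₚ.take⁺ k' (All.map (λ (sorted , LY , Y⊆Z) → sorted , L⇒L' LY , λ {_} → Y⊆Z) blocks) ,
    AllPairsₚ.take⁺ k' separated

  dotIter-mono : ∀ j {L L' : Family} {k k'} → (∀ {Y} → L Y → L' Y) → k' ≤ k →
                 ∀ {Z} → dotIter θ L k j Z → dotIter θ L' k' j Z
  dotIter-mono zero    L⇒L' _    = L⇒L'
  dotIter-mono (suc j) L⇒L' k'≤k = dotIter-mono j (dot-mono L⇒L' k'≤k) k'≤k

  dotIter-zero : ∀ j {L Z} → dotIter θ L 0 (suc j) Z
  dotIter-zero zero        = [] , refl , [] , []
  dotIter-zero (suc j) {L} = dotIter-zero j {dot θ L 0}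

  dot-block : ∀ {L k Z} → 0 < k → dot θ L k Z → ∃ λ Y → Y ⊆ Z × L Y
  dot-block ()  ([] , refl , _ , _)
  dot-block _   (Y ∷ _ , _ , (_ , LY , Y⊆Z) ∷ _ , _) = Y , Y⊆Z , LY

  dotIter-block : ∀ j {L k Z} → 0 < k → dotIter θ L k j Z → ∃ λ Y → Y ⊆ Z × L Y
  dotIter-block zero            _   LZ = _ , id , LZ
  dotIter-block (suc j) {L} {k} 0<k LZ with N , N⊆Z , LN ← dotIter-block j {dot θ L k} 0<k LZ
                                       with Y , Y⊆N , LY ← dot-block 0<k LN
    = Y , (λ y∈ → N⊆Z (Y⊆N y∈)) , LY

record HomIn (f : ℕ → ℕ) (G : Family) (Z : List ℕ) : Set where
  field
    colour   : ℕ
    W        : List ℕ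
    W-sorted : IsFinSet W
    W⊆Z      : W ⊆ Z
    W-in     : G W
    W≢[]     : W ≢ []
    W-colour : ∀ {x} → x ∈ W → f x ≡ colour

open HomIn

HomIn-map : ∀ {f G G' Z} → (∀ {Y} → G Y → G' Y) → HomIn f G Z → HomIn f G' Z
HomIn-map G⇒G' H = record
  { colour = colour H ; W = W H ; W-sorted = W-sorted H ; W⊆Z = W⊆Z H
  ; W-in = G⇒G' (W-in H) ; W≢[] = W≢[] H ; W-colour = W-colour H }

singleton-hom : ∀ {θ f y Z} → y ∈ Z → HomIn f (Large θ 0) Z
singleton-hom {f = f} {y} y∈Z = record
  { colour = f y ; W = y ∷ [] ; W-sorted = [-] ; W⊆Z = λ { (here refl) → y∈Z }
  ; W-in = λ () ; W≢[] = λ () ; W-colour = λ { (here refl) → refl } }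

module _ {θ : Formula} {f : ℕ → ℕ} where

  record Piece (G : Family) (Z : List ℕ) : Set where
    constructor piece
    field
      block        : List ℕ
      block-sorted : IsFinSet block
      block⊆Z      : block ⊆ Z
      hom          : HomIn f G block

  open Piece

  union-hom : ∀ {G Z c} (ps : List (Piece G Z)) → 0 < length ps →
              All (λ p → colour (hom p) ≡ c) ps → AllPairs (Separated θ on block) ps →
              HomIn f (dot θ G (length ps)) Z
  union-hom {G} {Z} {c} ps@(p₀ ∷ _) _ coloured separated = record
    { colour   = c
    ; W        = concat parts
    ; W-sorted = AllPairs⇒Linked (AllPairsₚ.concat⁺ parts-sorted parts-ordered)
    ; W⊆Z      = All.lookup (concat-All (All.tabulate λ {p} _ →
                   All.tabulate λ x∈ → block⊆Z p (W⊆Z (hom p) x∈)))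
    ; W-in     = parts , length-map part ps , parts-blocks , parts-separated
    ; W≢[]     = W≢[] (hom p₀) ∘ ++-conicalˡ (part p₀) _
    ; W-colour = All.lookup (concat-All (All.map (λ {p} p≡c →
                   All.tabulate λ x∈ → trans (W-colour (hom p) x∈) p≡c) coloured))
    }
    where
    part : Piece G Z → List ℕ
    part p = W (hom p)

    parts : List (List ℕ)
    parts = map part ps

    concat-All : ∀ {P : ℕ → Set} → All (λ p → All P (part p)) ps → All P (concat parts)
    concat-All = Allₚ.concat⁺ ∘ Allₚ.map⁺

    parts-sorted : All (AllPairs _<_) parts
    parts-sorted = Allₚ.map⁺ {xs = ps} (All.tabulate λ {p} _ →
      Linked⇒AllPairs <-trans (W-sorted (hom p)))

    parts-ordered : AllPairs (λ xs ys → All (λ x → All (x <_) ys) xs) parts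
    parts-ordered = AllPairsₚ.map⁺ (AllPairs.map (λ {p} {q} (p<q , _) →
      All.tabulate λ x∈ → All.tabulate λ y∈ → p<q (W⊆Z (hom p) x∈) (W⊆Z (hom q) y∈)) separated)

    parts-blocks : All (λ V → IsFinSet V × G V × V ⊆ concat parts) parts
    parts-blocks = Allₚ.map⁺ {xs = ps} (All.tabulate λ {p} p∈ →
      W-sorted (hom p) , W-in (hom p) , λ x∈ → ∈-concat⁺′ x∈ (∈-map⁺ part p∈))

    restrict : ∀ {p q} → Separated θ (block p) (block q) → Separated θ (part p) (part q)
    restrict {p} {q} (p<q , apart) =
      (λ x∈ y∈ → p<q (W⊆Z (hom p) x∈) (W⊆Z (hom q) y∈)) ,
      Apart-⊆ (block-sorted q) (W≢[] (hom q)) (W⊆Z (hom p)) (W⊆Z (hom q)) apart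

    parts-separated : AllPairs (Separated θ) parts
    parts-separated = AllPairsₚ.map⁺ {xs = ps} (AllPairs.map (λ {p} {q} → restrict {p} {q}) separated)

  homogeneous-union : ∀ {G Z} m K (ps : List (Piece G Z)) → All (λ p → colour (hom p) < m) ps →
                      m * K < length ps → AllPairs (Separated θ on block) ps → HomIn f (dot θ G K) Z
  homogeneous-union m K ps cols big separated
    with c , K<same ← pigeonhole (colour ∘ hom) m K ps cols big
    = HomIn-map (dot-mono id (<⇒≤ K<same))
        (union-hom (filter same? ps) (≤-<-trans z≤n K<same)
                   (Allₚ.all-filter same? ps) (AllPairsₚ.filter⁺ same? separated))
    where
    same? : Decidable (λ p → colour (hom p) ≡ c)
    same? p = colour (hom p) ≟ c

module Arrow (θ : Formula) (f : ℕ → ℕ) (m : ℕ) (U : List ℕ) (f<m : ∀ {x} → x ∈ U → f x < m) where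

  _↝_ : Family → Family → Set
  F ↝ G = ∀ {Y} → Y ⊆ U → F Y → HomIn f G Y

  colour<m : ∀ {G Y} → Y ⊆ U → (H : HomIn f G Y) → colour H < m
  colour<m Y⊆U H = subst (_< m) (W-colour H x∈) (f<m (Y⊆U (W⊆Z H x∈)))
    where x∈ = minL-∈ (W≢[] H)

  ↝-dot : ∀ {F G k K} → F ↝ G → m * K < k → dot θ F k ↝ dot θ G K
  ↝-dot {G = G} {K = K} F↝G mK<k {Z} Z⊆U (Ys , refl , blocks , separated) =
    homogeneous-union m K ps
      (All.tabulate λ {p} _ → colour<m (λ x∈ → Z⊆U (Piece.block⊆Z p x∈)) (Piece.hom p))
      (subst (m * K <_) (trans (cong length (sym blocks-of-ps)) (length-map Piece.block ps)) mK<k)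
      (AllPairsₚ.map⁻ (subst (AllPairs (Separated θ)) (sym blocks-of-ps) separated))
    where
    ps : List (Piece G Z)
    ps = All.reduce (λ (sorted , FY , Y⊆Z) → piece _ sorted Y⊆Z (F↝G (λ x∈ → Z⊆U (Y⊆Z x∈)) FY)) blocks
    blocks-of-ps : map Piece.block ps ≡ Ys
    blocks-of-ps = map-reduce Piece.block _ (λ _ → refl) blocks

  ↝-dotIter : ∀ j {F G k K} → F ↝ G → m * K < k → dotIter θ F k j ↝ dotIter θ G K j
  ↝-dotIter zero    F↝G _    = F↝G
  ↝-dotIter (suc j) F↝G mK<k = ↝-dotIter j (↝-dot F↝G mK<k) mK<k

module Sparse (θ : Formula) (f : ℕ → ℕ) (m : ℕ) (r : List ℕ) (sorted : IsFinSet (m ∷ r))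
              (sparse : ExpSparse (m ∷ r)) (f<m : ∀ {x} → x ∈ m ∷ r → f x < m) where

  open Arrow θ f m r (f<m ∘ there)

  0<m : 0 < m
  0<m = ≤-<-trans z≤n (f<m (here refl))

  instance
    m≢0 : NonZero m
    m≢0 = >-nonZero 0<m

  m<r : ∀ {x} → x ∈ r → m < x
  m<r = head-below sorted

  sparse-product : ∀ {x y} → x ∈ m ∷ r → y ∈ m ∷ r → x < y → m * x < y
  sparse-product {x} {y} x∈ y∈ x<y = begin-strict
    m * x   ≤⟨ *-monoˡ-≤ x (minL-≤ sorted x∈) ⟩
    x * x   <⟨ n*n<4^n x ⟩
    4 ^ x   <⟨ sparse x∈ y∈ x<y ⟩
    y       ∎
    where open ≤-Reasoning

  record Anchored (n : ℕ) (Y : List ℕ) : Set where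
    field
      anchor      : ℕ
      anchor∈     : anchor ∈ Y
      tail        : List ℕ
      tail-sorted : IsFinSet tail
      tail⊆       : tail ⊆ Y
      tail-colour : ∀ {x} → x ∈ tail → f x ≡ f anchor
      extends     : ∀ x → m * x < minL Y → Large θ (suc n) (x ∷ tail)

  open Anchored

  anchored-singleton : ∀ n → Anchored n (m ∷ [])
  anchored-singleton n = record
    { anchor = m ; anchor∈ = here refl ; tail = [] ; tail-sorted = [] ; tail⊆ = λ ()
    ; tail-colour = λ () ; extends = extends-[] }
    where
    extends-[] : ∀ x → m * x < m → Large θ (suc n) (x ∷ [])
    extends-[] zero    _    = dotIter-zero n
    extends-[] (suc x) mx<m = ⊥-elim (<⇒≱ mx<m (m≤m*n m (suc x)))

  glue-anchored : ∀ {n Y Y' Z} → Z ⊆ m ∷ r → Y ⊆ Z → Y' ⊆ Z → Y <ˢ Y' →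
         (A : Anchored n Y) (A' : Anchored n Y') → f (anchor A) ≡ f (anchor A') →
         HomIn f (Large θ (suc n)) Z
  glue-anchored {Y' = Y'} Z⊆X Y⊆Z Y'⊆Z Y<Y' A A' same = record
    { colour   = f (anchor A)
    ; W        = anchor A ∷ tail A'
    ; W-sorted = sorted-cons (λ x∈ → Y<Y' (anchor∈ A) (tail⊆ A' x∈)) (tail-sorted A')
    ; W⊆Z      = λ { (here refl) → Y⊆Z (anchor∈ A) ; (there x∈) → Y'⊆Z (tail⊆ A' x∈) }
    ; W-in     = extends A' (anchor A) (sparse-product (Z⊆X (Y⊆Z (anchor∈ A))) (Z⊆X (Y'⊆Z min∈))
                                                       (Y<Y' (anchor∈ A) min∈))
    ; W≢[]     = λ ()
    ; W-colour = λ { (here refl) → refl ; (there x∈) → trans (tail-colour A' x∈) (sym same) }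
    }
    where
    min∈ : minL Y' ∈ Y'
    min∈ = minL-∈ (∈⇒≢[] (anchor∈ A'))

  homogeneous-of-anchored : ∀ {n Z} (as : List (∃ (Anchored n))) → Z ⊆ m ∷ r →
                            All (λ a → proj₁ a ⊆ Z) as → m < length as → AllPairs (_<ˢ_ on proj₁) as →
                            HomIn f (Large θ (suc n)) Z
  homogeneous-of-anchored as Z⊆X as⊆Z big ordered
    with (Y , A) , (Y' , A') , a∈ , a'∈ , Y<Y' , same
         ← pigeonhole-pair (λ (_ , A) → f (anchor A)) m
             (All.map (λ {(_ , A)} Y⊆Z → f<m (Z⊆X (Y⊆Z (anchor∈ A)))) as⊆Z) big ordered
    = glue-anchored Z⊆X (All.lookup as⊆Z a∈) (All.lookup as⊆Z a'∈) Y<Y' A A' same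

  large⇒anchored : ∀ n {B} → B ⊆ r → Large θ (suc (suc n)) B → Anchored n B
  dot-large-↝ : ∀ n {b} → m < b → dot θ (Large θ (suc n)) b ↝ Large θ n
  anchored-blocks : ∀ n {k N} → N ⊆ r → dot θ (Large θ (suc (suc n))) k N →
                    Σ (List (∃ (Anchored n))) λ as →
                      length as ≡ k × All (λ a → proj₁ a ⊆ N) as × AllPairs (_<ˢ_ on proj₁) as

  large⇒anchored n {b ∷ rest} B⊆r LB = record
    { anchor      = minL (W H)
    ; anchor∈     = there (W⊆Z H min∈)
    ; tail        = W H
    ; tail-sorted = W-sorted H
    ; tail⊆       = λ x∈ → there (W⊆Z H x∈)
    ; tail-colour = λ x∈ → trans (W-colour H x∈) (sym (W-colour H min∈))
    ; extends     = λ x mx<b → dotIter-mono (suc n) id (m*o<n⇒o≤pred[n]/m m x mx<b) (W-in H)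
    }
    where
    m<b : m < b
    m<b = m<r (B⊆r (here refl))
    H : HomIn f (dotIter θ (Large θ n) (pred b / m) (suc n)) rest
    H = ↝-dotIter (suc n) (dot-large-↝ n m<b) (m*[pred[n]/m]<n m (≤-<-trans z≤n m<b))
          (λ x∈ → B⊆r (there x∈)) LB
    min∈ : minL (W H) ∈ W H
    min∈ = minL-∈ (W≢[] H)

  dot-large-↝ zero m<b N⊆r LN with dot-block (≤-<-trans z≤n m<b) LN
  ... | y ∷ _ , Y⊆N , _ = singleton-hom {θ = θ} (Y⊆N (here refl))
  dot-large-↝ (suc n) m<b N⊆r LN with as , len , as⊆N , ordered ← anchored-blocks n N⊆r LN
    = homogeneous-of-anchored as (λ x∈ → there (N⊆r x∈)) as⊆N (subst (m <_) (sym len) m<b) ordered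

  anchored-blocks n {N = N} N⊆r (Ys , refl , blocks , separated) =
    as ,
    trans (sym (length-map proj₁ as)) (cong length blocks-of-as) ,
    Allₚ.map⁻ (subst (All (_⊆ N)) (sym blocks-of-as) (All.map (λ (_ , _ , Y⊆N) {_} → Y⊆N) blocks)) ,
    AllPairsₚ.map⁻ (subst (AllPairs _<ˢ_) (sym blocks-of-as) (AllPairs.map proj₁ separated))
    where
    as : List (∃ (Anchored n))
    as = All.reduce (λ (_ , LY , Y⊆N) → _ , large⇒anchored n (λ x∈ → N⊆r (Y⊆N x∈)) LY) blocks
    blocks-of-as : map proj₁ as ≡ Ys
    blocks-of-as = map-reduce proj₁ _ (λ _ → refl) blocks

  homogeneous-large : ∀ n → Large θ (2 + n) (m ∷ r) → HomIn f (Large θ n) (m ∷ r)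
  homogeneous-large zero    _ = singleton-hom {θ = θ} (here refl)
  homogeneous-large (suc n) large
    with N , N⊆r , LN ← dotIter-block (2 + n) {dot θ (Large θ (2 + n)) m} 0<m large
    with as , len , as⊆N , ordered ← anchored-blocks n N⊆r LN
    = homogeneous-of-anchored ((m ∷ [] , anchored-singleton n) ∷ as) (λ x∈ → x∈)
        ((λ { (here refl) → here refl }) ∷ All.map (λ Y⊆N {_} x∈ → there (N⊆r (Y⊆N x∈))) as⊆N)
        (s≤s (≤-reflexive (sym len)))
        (All.tabulate (λ a∈ → λ { (here refl) y∈ → m<r (N⊆r (All.lookup as⊆N a∈ y∈)) }) ∷ ordered)

homogeneous-subset : ∀ θ f n X → IsFinSet X → Large θ (2 + n) X → ExpSparse X →
                     (∀ {x} → x ∈ X → f x < minL X) → HomIn f (Large θ n) X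
homogeneous-subset θ f n (m ∷ r) sorted large sparse f<m =
  Sparse.homogeneous-large θ f m r sorted sparse f<m n large

corollary3p19 : (θ : Formula) → (∀ x y z → Dec (θ x y z)) →
    (n : ℕ) (X : List ℕ) → IsFinSet X →
    Large θ (n + 2) X → ExpSparse X →
    (f : ℕ → ℕ) → (∀ {x} → x ∈ X → f x < minL X) →
    Σ (List ℕ) λ H → IsFinSet H × H ⊆ X × Large θ n H ×
      (∃ λ c → ∀ {h} → h ∈ H → f h ≡ c)
corollary3p19 θ _ n X sorted large sparse f f<min =
  W H , W-sorted H , W⊆Z H , W-in H , colour H , W-colour H
  where
  H : HomIn f (Large θ n) X
  H = homogeneous-subset θ f n X sorted (subst (λ k → Large θ k X) (+-comm n 2) large) sparse f<min
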